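{- Let $D$ be an Eulerian digraph on $n$ vertices, and let $d = |A(D)|/n$ be its average out-degree. Then for every vertex $v \in V(D)$ there exists a directed path starting at $v$ of length at least $\sqrt{2d}-3/2$.
   Context: Digraphs are finite and have no loops and no multiple arcs (two arcs with the same tail and the same head); a pair of opposite arcs $uv, vu$ is allowed. A digraph is Eulerian if it is strongly connected and every vertex has out-degree equal to its in-degree. The length of a directed path is its number of arcs (a single vertex is a path of length $0$). -}

module Defs where

open import Data.Nat using (ℕ; zero; suc; _+_; _*_; _≤_)
open import Data.Bool using (Bool; true; false)
open import Data.Fin using (Fin; zero; suc; inject₁)
open import Data.List using (List; length; filterᵇ; map)
open import Data.Nat.ListAction using (sum)
open import Data.Vec using (Vec; lookup; head)
open import Data.Product using (Σ; _×_; ∃)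
open import Relation.Binary.PropositionalEquality using (_≡_)
open import Function.Definitions using (Injective)

open import Data.List using (allFin) public

-- A digraph on vertex set Fin n: an arc relation given by a Boolean
-- adjacency matrix (so no multiple arcs; opposite arcs allowed),
-- without loops.
record Digraph (n : ℕ) : Set where
  field
    arc      : Fin n → Fin n → Bool
    loopless : ∀ v → arc v v ≡ false
open Digraph public

module _ {n : ℕ} (D : Digraph n) where

  outdeg : Fin n → ℕ
  outdeg v = length (filterᵇ (λ u → arc D v u) (allFin n))

  indeg : Fin n → ℕ
  indeg v = length (filterᵇ (λ u → arc D u v) (allFin n))

  numArcs : ℕ
  numArcs = sum (map outdeg (allFin n))

  data Walk : Fin n → Fin n → Set where
    here  : ∀ {u} → Walk u u
    step  : ∀ {u w v} → arc D u w ≡ true → Walk w v → Walk u v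

  StronglyConnected : Set
  StronglyConnected = ∀ u v → Walk u v

  Eulerian : Set
  Eulerian = StronglyConnected × (∀ v → outdeg v ≡ indeg v)

  IsPath : (L : ℕ) → Vec (Fin n) (suc L) → Set
  IsPath L p =
    (∀ (i : Fin L) → arc D (lookup p (inject₁ i)) (lookup p (suc i)) ≡ true)
    × Injective _≡_ _≡_ (lookup p)

  PathFrom : Fin n → ℕ → Set
  PathFrom v L = Σ (Vec (Fin n) (suc L)) λ p → head p ≡ v × IsPath L p

module Submission where

-- Let f w be the length of a longest path from v to w, and L the largest of these.
-- For an arc u → w, either w is the (i+1)-st vertex before u on a longest path P
-- from v to u, and the part of P ending at w gives f w ≥ f u ∸ (i + 1), or P extends
-- to w and f w ≥ f u + 1.  Either way the descent 1 + f u ∸ f w of the arc is at most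
-- i + 2, with distinct i for distinct w, so the descents of the arcs leaving u add up
-- to at most 2 + 3 + ⋯ + (f u + 1) = f u (f u + 3) / 2.  Summing
-- 1 + f u ≤ f w + (1 + f u ∸ f w) over all arcs, the potentials cancel because D is
-- balanced, hence |A| ≤ n L (L + 3) / 2, i.e. 8 |A| ≤ n (2L + 3)².

open import Defs
open import Data.Nat using (ℕ; zero; suc; _+_; _*_; _∸_; _≤_; z≤n; s≤s; s≤s⁻¹)
open import Data.Nat.Properties hiding (_≟_)
open import Data.Nat.Tactic.RingSolver using (solve-∀)
open import Data.Bool using (Bool; true; false; if_then_else_)
import Data.Bool.Properties as Bool
open import Data.Fin using (Fin; zero; suc; inject₁; fromℕ)
open import Data.Fin.Properties using (_≟_; any?; injective⇒≤)
open import Data.Fin.Relation.Unary.Top using (view; ‵fromℕ; ‵inject₁)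
open import Data.List using (List; []; _∷_; length; filterᵇ; map; tabulate)
import Data.List as List
import Data.Nat.ListAction as ListAction
open import Data.List.Membership.Propositional using (_∈_; _∉_)
open import Data.List.Membership.Propositional.Properties using (∈-lookup)
open import Data.List.Relation.Unary.All as All using ([]; _∷_)
open import Data.List.Relation.Unary.All.Properties using (¬Any⇒All¬)
open import Data.List.Relation.Unary.Any using (here; there)
import Data.List.Relation.Unary.Unique.DecPropositional as UniqueDec
import Data.List.Membership.DecPropositional as MembershipDec
open import Data.List.Relation.Unary.Unique.Propositional using (Unique; []; _∷_)
open import Data.Vec using (Vec; lookup; head; _∷ʳ_) renaming ([] to []ᵥ; _∷_ to _∷ᵥ_)
open import Data.Product using (Σ; _×_; _,_; proj₁; proj₂)
open import Data.Empty using (⊥-elim)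
open import Function using (_∘_; id)
open import Function.Definitions using (Injective)
open import Relation.Binary.PropositionalEquality
open import Relation.Nullary using (Dec; yes; no; does)
open import Relation.Nullary.Decidable using (map′; _×-dec_; dec-true)
open import Relation.Unary using (Decidable)
open import Algebra.Properties.Semiring.Sum +-*-semiring
  using (sum; sum-syntax; sum-cong-≗; sum-replicate-zero; ∑-distrib-+; ∑-comm; *-distribˡ-sum; *-distribʳ-sum)

𝟙 : Bool → ℕ
𝟙 true  = 1
𝟙 false = 0

sum-mono-≤ : ∀ {m} {g h : Fin m → ℕ} → (∀ i → g i ≤ h i) → sum g ≤ sum h
sum-mono-≤ {zero}  _   = z≤n
sum-mono-≤ {suc m} g≤h = +-mono-≤ (g≤h zero) (sum-mono-≤ (g≤h ∘ suc))

sum-≤-* : ∀ {m c} {g : Fin m → ℕ} → (∀ i → g i ≤ c) → sum g ≤ m * c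
sum-≤-* {zero}  _   = z≤n
sum-≤-* {suc m} g≤c = +-mono-≤ (g≤c zero) (sum-≤-* (g≤c ∘ suc))

∑-if-≟ : ∀ {m} (y : Fin m) c → ∑[ w < m ] (if does (y ≟ w) then c else 0) ≡ c
∑-if-≟ {suc m} zero    c = trans (cong (c +_) (sum-replicate-zero m)) (+-identityʳ c)
∑-if-≟ {suc m} (suc y) c = ∑-if-≟ y c

sum-map-tabulate : ∀ {A : Set} {m} (h : A → ℕ) (g : Fin m → A) →
  ListAction.sum (map h (tabulate g)) ≡ ∑[ i < m ] h (g i)
sum-map-tabulate {m = zero}  h g = refl
sum-map-tabulate {m = suc m} h g = cong (h (g zero) +_) (sum-map-tabulate h (g ∘ suc))

length-filterᵇ-tabulate : ∀ {A : Set} {m} (p : A → Bool) (g : Fin m → A) →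
  length (filterᵇ p (tabulate g)) ≡ ∑[ i < m ] 𝟙 (p (g i))
length-filterᵇ-tabulate {m = zero}  p g = refl
length-filterᵇ-tabulate {m = suc m} p g with p (g zero)
... | true  = cong suc (length-filterᵇ-tabulate p (g ∘ suc))
... | false = length-filterᵇ-tabulate p (g ∘ suc)

∑∑ : ∀ {m} → (Fin m → Fin m → ℕ) → ℕ
∑∑ {m} g = ∑[ u < m ] ∑[ w < m ] g u w

∑∑-distrib-+ : ∀ {m} (g h : Fin m → Fin m → ℕ) →
  ∑∑ (λ u w → g u w + h u w) ≡ ∑∑ g + ∑∑ h
∑∑-distrib-+ {m} g h = trans (sum-cong-≗ (λ u → ∑-distrib-+ (g u) (h u)))
                             (∑-distrib-+ (λ u → ∑[ w < m ] g u w) (λ u → ∑[ w < m ] h u w))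

∑∑-mono-≤ : ∀ {m} {g h : Fin m → Fin m → ℕ} → (∀ u w → g u w ≤ h u w) → ∑∑ g ≤ ∑∑ h
∑∑-mono-≤ g≤h = sum-mono-≤ (λ u → sum-mono-≤ (g≤h u))

∑∑-cong : ∀ {m} {g h : Fin m → Fin m → ℕ} → (∀ u w → g u w ≡ h u w) → ∑∑ g ≡ ∑∑ h
∑∑-cong g≡h = sum-cong-≗ (λ u → sum-cong-≗ (g≡h u))

module Balanced {m} (a : Fin m → Fin m → ℕ)
                (balanced : ∀ u → ∑[ w < m ] a u w ≡ ∑[ w < m ] a w u) where

  ∑∑-source≡∑∑-target : (f : Fin m → ℕ) →
    ∑∑ (λ u w → a u w * f u) ≡ ∑∑ (λ u w → a u w * f w)
  ∑∑-source≡∑∑-target f = begin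
    ∑∑ (λ u w → a u w * f u)               ≡⟨ sum-cong-≗ (λ u → *-distribʳ-sum (f u) (a u)) ⟨
    ∑[ u < m ] (∑[ w < m ] a u w * f u)    ≡⟨ sum-cong-≗ (λ u → cong (_* f u) (balanced u)) ⟩
    ∑[ u < m ] (∑[ w < m ] a w u * f u)    ≡⟨ sum-cong-≗ (λ u → *-distribʳ-sum (f u) (λ w → a w u)) ⟩
    ∑∑ (λ u w → a w u * f u)               ≡⟨ ∑-comm (λ u w → a w u * f u) ⟩
    ∑∑ (λ u w → a u w * f w)               ∎
    where open ≡-Reasoning

  ∑∑≤∑∑-descent : (f : Fin m → ℕ) →
    ∑∑ a ≤ ∑∑ (λ u w → a u w * (suc (f u) ∸ f w))
  ∑∑≤∑∑-descent f = +-cancelʳ-≤ T _ _ (begin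
    ∑∑ a + T                                              ≡⟨ ∑∑-distrib-+ a (λ u w → a u w * f u) ⟨
    ∑∑ (λ u w → a u w + a u w * f u)                      ≡⟨ ∑∑-cong (λ u w → *-suc (a u w) (f u)) ⟨
    ∑∑ (λ u w → a u w * suc (f u))                        ≤⟨ ∑∑-mono-≤ (λ u w → *-monoʳ-≤ (a u w) (m≤n+m∸n (suc (f u)) (f w))) ⟩
    ∑∑ (λ u w → a u w * (f w + (suc (f u) ∸ f w)))        ≡⟨ ∑∑-cong (λ u w → *-distribˡ-+ (a u w) (f w) _) ⟩
    ∑∑ (λ u w → a u w * f w + a u w * (suc (f u) ∸ f w))  ≡⟨ ∑∑-distrib-+ (λ u w → a u w * f w) _ ⟩
    ∑∑ (λ u w → a u w * f w) + Desc                        ≡⟨ cong (_+ Desc) (∑∑-source≡∑∑-target f) ⟨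
    T + Desc                                              ≡⟨ +-comm T Desc ⟩
    Desc + T                                              ∎)
    where
    open ≤-Reasoning
    T Desc : ℕ
    T    = ∑∑ (λ u w → a u w * f u)
    Desc = ∑∑ (λ u w → a u w * (suc (f u) ∸ f w))

greatest : {P : ℕ → Set} → Decidable P → ∀ {B} → (∀ {k} → P k → k ≤ B) →
  ∀ {m} → P m → Σ ℕ λ k → P k × (∀ {j} → P j → j ≤ k)
greatest {P} P? {B} bound pm with P? B
... | yes pB = B , pB , bound
greatest {P} P? {zero}  bound pm | no ¬pB = ⊥-elim (¬pB (subst P (n≤0⇒n≡0 (bound pm)) pm))
greatest {P} P? {suc B} bound pm | no ¬pB = greatest P? bound′ pm
  where
  bound′ : ∀ {k} → P k → k ≤ B
  bound′ pk = s≤s⁻¹ (≤∧≢⇒< (bound pk) λ { refl → ¬pB pk })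

∃-length? : ∀ {m} {P : List (Fin m) → Set} → Decidable P →
  ∀ k → Dec (Σ (List (Fin m)) λ xs → length xs ≡ k × P xs)
∃-length? P? zero = map′ (λ p → [] , refl , p) (λ { ([] , _ , p) → p ; (_ ∷ _ , () , _) }) (P? [])
∃-length? P? (suc k) =
  map′ (λ { (x , xs , refl , p) → x ∷ xs , refl , p })
       (λ { (x ∷ xs , refl , p) → x , xs , refl , p })
       (any? λ x → ∃-length? (P? ∘ (x ∷_)) k)

Unique⇒lookup-injective : ∀ {A : Set} {xs : List A} → Unique xs → Injective _≡_ _≡_ (List.lookup xs)
Unique⇒lookup-injective (_ ∷ _)    {zero}  {zero}  _ = refl
Unique⇒lookup-injective (x∉xs ∷ _) {zero}  {suc j} e = ⊥-elim (All.lookup x∉xs (∈-lookup j) e)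
Unique⇒lookup-injective (x∉xs ∷ _) {suc i} {zero}  e = ⊥-elim (All.lookup x∉xs (∈-lookup i) (sym e))
Unique⇒lookup-injective (_ ∷ !xs)  {suc i} {suc j} e = cong suc (Unique⇒lookup-injective !xs e)

Unique⇒length≤ : ∀ {n} {xs : List (Fin n)} → Unique xs → length xs ≤ n
Unique⇒length≤ = injective⇒≤ ∘ Unique⇒lookup-injective

module _ {n : ℕ} where

  weight : ℕ → List (Fin n) → Fin n → ℕ
  weight k []       w = 0
  weight k (y ∷ ys) w = (if does (y ≟ w) then k else 0) + weight (suc k) ys w

  ∑-weight : ∀ k ys → 2 * (∑[ w < n ] weight k ys w) + length ys ≡ length ys * (2 * k + length ys)
  ∑-weight k []       = cong (λ s → 2 * s + 0) (sum-replicate-zero n)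
  ∑-weight k (y ∷ ys) = begin
    2 * (∑[ w < n ] weight k (y ∷ ys) w) + suc l    ≡⟨ cong (λ s → 2 * s + suc l) ∑-head ⟩
    2 * (k + S) + suc l                            ≡⟨ regroup k S l ⟩
    (2 * S + l) + (2 * k + 1)                      ≡⟨ cong (_+ (2 * k + 1)) (∑-weight (suc k) ys) ⟩
    l * (2 * suc k + l) + (2 * k + 1)              ≡⟨ expand k l ⟩
    suc l * (2 * k + suc l)                        ∎
    where
    open ≡-Reasoning
    l S : ℕ
    l = length ys
    S = ∑[ w < n ] weight (suc k) ys w
    ∑-head : ∑[ w < n ] weight k (y ∷ ys) w ≡ k + S
    ∑-head = trans (∑-distrib-+ (λ w → if does (y ≟ w) then k else 0) (weight (suc k) ys))
                   (cong (_+ S) (∑-if-≟ y k))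
    regroup : ∀ k S l → 2 * (k + S) + suc l ≡ (2 * S + l) + (2 * k + 1)
    regroup = solve-∀
    expand : ∀ k l → l * (2 * suc k + l) + (2 * k + 1) ≡ suc l * (2 * k + suc l)
    expand = solve-∀

  ∑-weight-2 : ∀ ys → 2 * ∑[ w < n ] weight 2 ys w ≡ length ys * (length ys + 3)
  ∑-weight-2 ys = +-cancelʳ-≡ l _ _ (trans (∑-weight 2 ys) (split l))
    where
    l : ℕ
    l = length ys
    split : ∀ l → l * (2 * 2 + l) ≡ l * (l + 3) + l
    split = solve-∀

module _ {A : Set} where

  head-∷ʳ : ∀ {m} (xs : Vec A (suc m)) x → head (xs ∷ʳ x) ≡ head xs
  head-∷ʳ (_ ∷ᵥ _) x = refl

  lookup-∷ʳ-fromℕ : ∀ {m} (xs : Vec A m) x → lookup (xs ∷ʳ x) (fromℕ m) ≡ x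
  lookup-∷ʳ-fromℕ []ᵥ       x = refl
  lookup-∷ʳ-fromℕ (_ ∷ᵥ xs) x = lookup-∷ʳ-fromℕ xs x

  lookup-∷ʳ-inject₁ : ∀ {m} (xs : Vec A m) x i → lookup (xs ∷ʳ x) (inject₁ i) ≡ lookup xs i
  lookup-∷ʳ-inject₁ (_ ∷ᵥ xs) x zero    = refl
  lookup-∷ʳ-inject₁ (_ ∷ᵥ xs) x (suc i) = lookup-∷ʳ-inject₁ xs x i

module _ {n} (D : Digraph n) where

  IsPath-∷ʳ : ∀ {L} {p : Vec (Fin n) (suc L)} {w} → IsPath D L p →
    arc D (lookup p (fromℕ L)) w ≡ true → (∀ i → lookup p i ≢ w) → IsPath D (suc L) (p ∷ʳ w)
  IsPath-∷ʳ {L} {p} {w} (arcs , injective) last→w fresh = arcs′ , injective′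
    where
    old : ∀ i → lookup (p ∷ʳ w) (inject₁ i) ≡ lookup p i
    old = lookup-∷ʳ-inject₁ p w
    new : lookup (p ∷ʳ w) (fromℕ (suc L)) ≡ w
    new = lookup-∷ʳ-fromℕ p w

    arcs′ : ∀ i → arc D (lookup (p ∷ʳ w) (inject₁ i)) (lookup (p ∷ʳ w) (suc i)) ≡ true
    arcs′ i with view i
    ... | ‵fromℕ     rewrite old (fromℕ L)   | new         = last→w
    ... | ‵inject₁ j rewrite old (inject₁ j) | old (suc j) = arcs j

    injective′ : Injective _≡_ _≡_ (lookup (p ∷ʳ w))
    injective′ {i} {j} e with view i | view j
    ... | ‵fromℕ      | ‵fromℕ      = refl
    ... | ‵fromℕ      | ‵inject₁ j′ = ⊥-elim (fresh j′ (trans (sym (old j′)) (trans (sym e) new)))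
    ... | ‵inject₁ i′ | ‵fromℕ      = ⊥-elim (fresh i′ (trans (sym (old i′)) (trans e new)))
    ... | ‵inject₁ i′ | ‵inject₁ j′ = cong inject₁ (injective (trans (sym (old i′)) (trans e (old j′))))

  adj : Fin n → Fin n → ℕ
  adj u w = 𝟙 (arc D u w)

  outdeg≡∑adj : ∀ u → outdeg D u ≡ ∑[ w < n ] adj u w
  outdeg≡∑adj u = length-filterᵇ-tabulate (arc D u) id

  indeg≡∑adj : ∀ u → indeg D u ≡ ∑[ w < n ] adj w u
  indeg≡∑adj u = length-filterᵇ-tabulate (λ w → arc D w u) id

  numArcs≡∑∑adj : numArcs D ≡ ∑∑ adj
  numArcs≡∑∑adj = trans (sum-map-tabulate (outdeg D) id) (sum-cong-≗ outdeg≡∑adj)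

module LongestPaths {n} (D : Digraph n) (v : Fin n) where

  open MembershipDec (_≟_ {n}) using (_∈?_)
  open UniqueDec (_≟_ {n}) using (unique?)

  -- BackWalk w us: the list w ∷ us, read from right to left, is a walk from v to w.
  data BackWalk : Fin n → List (Fin n) → Set where
    []  : BackWalk v []
    _∷_ : ∀ {u w us} → arc D u w ≡ true → BackWalk u us → BackWalk w (u ∷ us)

  BackPath : Fin n → List (Fin n) → Set
  BackPath w us = BackWalk w us × Unique (w ∷ us)

  backWalk? : ∀ w us → Dec (BackWalk w us)
  backWalk? w [] with w ≟ v
  ... | yes refl = yes []
  ... | no w≢v   = no λ { [] → w≢v refl }
  backWalk? w (u ∷ us) with arc D u w Bool.≟ true | backWalk? u us
  ... | yes uw | yes p = yes (uw ∷ p)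
  ... | no ¬uw | _     = no λ { (uw ∷ _) → ¬uw uw }
  ... | yes _  | no ¬p = no λ { (_ ∷ p) → ¬p p }

  backPath? : ∀ w → Decidable (BackPath w)
  backPath? w us = backWalk? w us ×-dec unique? (w ∷ us)

  trivialPath : BackPath v []
  trivialPath = [] , [] ∷ []

  extend : ∀ {u w us} → BackPath u us → arc D u w ≡ true → w ∉ us → BackPath w (u ∷ us)
  extend {u} {w} {us} (p , !u∷us) uw w∉us = uw ∷ p , ¬Any⇒All¬ (u ∷ us) w∉u∷us ∷ !u∷us
    where
    w∉u∷us : w ∉ u ∷ us
    w∉u∷us (here w≡u) with () ← trans (sym (loopless D w)) (subst (λ x → arc D x w ≡ true) (sym w≡u) uw)
    w∉u∷us (there w∈us) = w∉us w∈us

  shortcut : ∀ k {u w us} → BackPath u us → w ∈ us →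
    Σ (List (Fin n)) λ zs → BackPath w zs × k + length us ≤ suc (weight k us w + length zs)
  shortcut k {w = w} {us = _ ∷ zs} (_ ∷ p , _ ∷ !w∷zs) (here refl) = zs , (p , !w∷zs) , bound
    where
    bound : k + suc (length zs) ≤ suc (weight k (w ∷ zs) w + length zs)
    bound rewrite dec-true (w ≟ w) refl | +-suc k (length zs) =
      s≤s (+-monoˡ-≤ (length zs) (m≤m+n k (weight (suc k) zs w)))
  shortcut k {w = w} {us = y ∷ ys} (_ ∷ p , _ ∷ !y∷ys) (there w∈ys)
    with zs , q , bound ← shortcut (suc k) (p , !y∷ys) w∈ys =
    zs , q , (begin
      k + suc (length ys)                                  ≡⟨ +-suc k (length ys) ⟩
      suc k + length ys                                    ≤⟨ bound ⟩
      suc (weight (suc k) ys w + length zs)                ≤⟨ s≤s (+-monoˡ-≤ (length zs) (m≤n+m _ _)) ⟩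
      suc (weight k (y ∷ ys) w + length zs)                ∎)
    where open ≤-Reasoning

  reachable : ∀ {u w us} → BackPath u us → Walk D u w → Σ (List (Fin n)) (BackPath w)
  reachable p here = _ , p
  reachable {us = us} p (step {w = x} ux walk) with x ∈? us
  ... | yes x∈us = reachable (proj₁ (proj₂ (shortcut 0 p x∈us))) walk
  ... | no  x∉us = reachable (extend p ux x∉us) walk

  toVec : ∀ {w us} → BackWalk w us → Vec (Fin n) (suc (length us))
  toVec {w} []      = w ∷ᵥ []ᵥ
  toVec {w} (_ ∷ p) = toVec p ∷ʳ w

  head-toVec : ∀ {w us} (p : BackWalk w us) → head (toVec p) ≡ v
  head-toVec []      = refl
  head-toVec (_ ∷ p) = trans (head-∷ʳ (toVec p) _) (head-toVec p)

  lookup-toVec-last : ∀ {w us} (p : BackWalk w us) → lookup (toVec p) (fromℕ (length us)) ≡ w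
  lookup-toVec-last []      = refl
  lookup-toVec-last (_ ∷ p) = lookup-∷ʳ-fromℕ (toVec p) _

  lookup-toVec-∈ : ∀ {w us} (p : BackWalk w us) i → lookup (toVec p) i ∈ w ∷ us
  lookup-toVec-∈ [] zero = here refl
  lookup-toVec-∈ {w} (_ ∷ p) i with view i
  ... | ‵fromℕ     = here (lookup-∷ʳ-fromℕ (toVec p) w)
  ... | ‵inject₁ j = there (subst (_∈ _) (sym (lookup-∷ʳ-inject₁ (toVec p) w j)) (lookup-toVec-∈ p j))

  toVec-isPath : ∀ {w us} (p : BackWalk w us) → Unique (w ∷ us) → IsPath D (length us) (toVec p)
  toVec-isPath []        _                  = (λ ()) , λ { {zero} {zero} _ → refl }
  toVec-isPath {w} (uw ∷ p) (w∉u∷us ∷ !u∷us) =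
    IsPath-∷ʳ D {p = toVec p} (toVec-isPath p !u∷us)
      (subst (λ x → arc D x w ≡ true) (sym (lookup-toVec-last p)) uw)
      (λ i e → All.lookup w∉u∷us (lookup-toVec-∈ p i) (sym e))

  toPathFrom : ∀ {w us} → BackPath w us → PathFrom D v (length us)
  toPathFrom (p , !w∷us) = toVec p , head-toVec p , toVec-isPath p !w∷us

  BackPathOfLength : Fin n → ℕ → Set
  BackPathOfLength w k = Σ (List (Fin n)) λ us → length us ≡ k × BackPath w us

  length≤n : ∀ {w k} → BackPathOfLength w k → k ≤ n
  length≤n (us , refl , _ , !w∷us) = <⇒≤ (Unique⇒length≤ !w∷us)

  module _ (reach : ∀ w → Walk D v w) where

    record LongestBackPath (w : Fin n) : Set where
      field
        route   : List (Fin n)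
        isPath  : BackPath w route
        longest : ∀ {us} → BackPath w us → length us ≤ length route

    longestBackPath : ∀ w → LongestBackPath w
    longestBackPath w
      with us , p ← reachable trivialPath (reach w)
      with _ , (us′ , refl , p′) , maximal ← greatest (∃-length? (backPath? w)) length≤n (us , refl , p)
      = record { route = us′ ; isPath = p′ ; longest = λ q → maximal (_ , refl , q) }

    route : Fin n → List (Fin n)
    route w = LongestBackPath.route (longestBackPath w)

    route-path : ∀ w → BackPath w (route w)
    route-path w = LongestBackPath.isPath (longestBackPath w)

    f : Fin n → ℕ
    f w = length (route w)

    f-maximal : ∀ {w us} → BackPath w us → length us ≤ f w
    f-maximal = LongestBackPath.longest (longestBackPath _)

    descent≤weight : ∀ {u w} → arc D u w ≡ true → suc (f u) ∸ f w ≤ weight 2 (route u) w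
    descent≤weight {u} {w} uw with w ∈? route u
    ... | yes w∈route with zs , q , bound ← shortcut 2 (route-path u) w∈route =
      m≤n+o⇒m∸n≤o (suc (f u)) (f w) (begin
        suc (f u)                              ≤⟨ s≤s⁻¹ bound ⟩
        weight 2 (route u) w + length zs       ≤⟨ +-monoʳ-≤ _ (f-maximal q) ⟩
        weight 2 (route u) w + f w             ≡⟨ +-comm _ (f w) ⟩
        f w + weight 2 (route u) w             ∎)
      where open ≤-Reasoning
    ... | no w∉route = ≤-trans (≤-reflexive (m≤n⇒m∸n≡0 longer)) z≤n
      where
      longer : suc (f u) ≤ f w
      longer = f-maximal (extend (route-path u) uw w∉route)

    ∑-descent≤ : ∀ u → 2 * ∑[ w < n ] (adj D u w * (suc (f u) ∸ f w)) ≤ f u * (f u + 3)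
    ∑-descent≤ u = begin
      2 * ∑[ w < n ] (adj D u w * (suc (f u) ∸ f w)) ≤⟨ *-monoʳ-≤ 2 (sum-mono-≤ term≤weight) ⟩
      2 * ∑[ w < n ] weight 2 (route u) w            ≡⟨ ∑-weight-2 (route u) ⟩
      f u * (f u + 3)                                ∎
      where
      open ≤-Reasoning
      term≤weight : ∀ w → 𝟙 (arc D u w) * (suc (f u) ∸ f w) ≤ weight 2 (route u) w
      term≤weight w with arc D u w in uw
      ... | false = z≤n
      ... | true  = ≤-trans (≤-reflexive (*-identityˡ _)) (descent≤weight uw)

    longestPathFrom : Σ ℕ λ L → PathFrom D v L × (∀ u → f u ≤ L)
    longestPathFrom with greatest (λ k → any? λ w → ∃-length? (backPath? w) k)
                                  (λ (_ , p) → length≤n p) (v , [] , refl , trivialPath)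
    ... | L , (_ , us , |us|≡L , p) , maximal =
      L , subst (PathFrom D v) |us|≡L (toPathFrom p) , λ u → maximal (u , route u , refl , route-path u)

    numArcs-bound : (∀ u → outdeg D u ≡ indeg D u) → ∀ {L} → (∀ u → f u ≤ L) →
      8 * numArcs D ≤ n * ((2 * L + 3) * (2 * L + 3))
    numArcs-bound degrees {L} f≤L = begin
      8 * numArcs D                   ≡⟨ cong (8 *_) (numArcs≡∑∑adj D) ⟩
      8 * ∑∑ (adj D)                  ≤⟨ *-monoʳ-≤ 8 (∑∑≤∑∑-descent f) ⟩
      8 * ∑[ u < n ] descent u        ≡⟨ *-assoc 4 2 (∑[ u < n ] descent u) ⟩
      4 * (2 * ∑[ u < n ] descent u)  ≡⟨ cong (4 *_) (*-distribˡ-sum 2 descent) ⟩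
      4 * ∑[ u < n ] (2 * descent u)  ≤⟨ *-monoʳ-≤ 4 (sum-≤-* (λ u → ≤-trans (∑-descent≤ u) (f²+3f≤ u))) ⟩
      4 * (n * (L * (L + 3)))         ≤⟨ completeSquare n L ⟩
      n * ((2 * L + 3) * (2 * L + 3)) ∎
      where
      open ≤-Reasoning
      open Balanced (adj D) (λ u → trans (sym (outdeg≡∑adj D u)) (trans (degrees u) (indeg≡∑adj D u)))
      descent : Fin n → ℕ
      descent u = ∑[ w < n ] (adj D u w * (suc (f u) ∸ f w))
      f²+3f≤ : ∀ u → f u * (f u + 3) ≤ L * (L + 3)
      f²+3f≤ u = *-mono-≤ (f≤L u) (+-monoˡ-≤ 3 (f≤L u))
      expand : ∀ n L → n * ((2 * L + 3) * (2 * L + 3)) ≡ 4 * (n * (L * (L + 3))) + n * 9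
      expand = solve-∀
      completeSquare : ∀ n L → 4 * (n * (L * (L + 3))) ≤ n * ((2 * L + 3) * (2 * L + 3))
      completeSquare n L = subst (4 * (n * (L * (L + 3))) ≤_) (sym (expand n L)) (m≤m+n _ _)

mainTheorem2 : (n : ℕ) (D : Digraph n) → Eulerian D → (v : Fin n) →
    Σ ℕ λ L → PathFrom D v L × 8 * numArcs D ≤ n * ((2 * L + 3) * (2 * L + 3))
mainTheorem2 _ D (strong , degrees) v =
  let L , path , f≤L = longestPathFrom (strong v)
  in  L , path , numArcs-bound (strong v) degrees f≤L
  where open LongestPaths D v
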